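{- Let $u\in\{\mathtt{0},\mathtt{1}\}^*$. Then $\mu_q(\widetilde{u}\mathtt{1}\mathtt{0}u)-\mu_q(\widetilde{u}\mathtt{0}\mathtt{1}u)=q^nD_q=\det(\mu_q(u))D_q$, where $n=2|u|_{\mathtt{0}}+4|u|_{\mathtt{1}}$ and $D_q=\mu_q(\mathtt{1}\mathtt{0})-\mu_q(\mathtt{0}\mathtt{1})=\begin{pmatrix}0 & q+q^4\\ -q^2-q^5 & 0\end{pmatrix}$.
   Context: $\widetilde{u}$ is the reversal of $u$; $|u|_a$ is the number of occurrences of the letter $a$ in $u$. $\mu_q$ is the monoid homomorphism $\{\mathtt{0},\mathtt{1}\}^*\to\mathrm{GL}_2(\mathbb{Z}[q^{\pm1}])$ with $\mu_q(\mathtt{0})=\begin{pmatrix} q+q^2 & 1\\ q & 1\end{pmatrix}$ and $\mu_q(\mathtt{1})=\begin{pmatrix} q+2q^2+q^3+q^4 & 1+q\\ q+q^2 & 1\end{pmatrix}$. -}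

module Defs where

open import Algebra.Bundles using (CommutativeRing)
open import Data.List using (List; []; _∷_; foldr)
open import Data.Nat using (ℕ; zero; suc)
open import Data.Product using (_×_; _,_)

data Bit : Set where
  b0 b1 : Bit

count0 : List Bit → ℕ
count0 [] = zero
count0 (b0 ∷ u) = suc (count0 u)
count0 (b1 ∷ u) = count0 u

count1 : List Bit → ℕ
count1 [] = zero
count1 (b0 ∷ u) = count1 u
count1 (b1 ∷ u) = suc (count1 u)

-- 2x2 matrices over a commutative ring R, and the morphism mu_q for a
-- chosen element q of R (q will be assumed invertible, modelling Z[q^{±1}]).
module Mat {c ℓ} (R : CommutativeRing c ℓ) (q : CommutativeRing.Carrier R) where
  open CommutativeRing R public

  record M2 : Set c where
    constructor mat
    field
      m₁₁ m₁₂ m₂₁ m₂₂ : Carrier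
  open M2 public

  infixl 7 _⊗_ _·_
  infixl 6 _⊖_
  infix 4 _≋_

  _⊗_ : M2 → M2 → M2
  A ⊗ B = mat (m₁₁ A * m₁₁ B + m₁₂ A * m₂₁ B) (m₁₁ A * m₁₂ B + m₁₂ A * m₂₂ B)
              (m₂₁ A * m₁₁ B + m₂₂ A * m₂₁ B) (m₂₁ A * m₁₂ B + m₂₂ A * m₂₂ B)

  _⊖_ : M2 → M2 → M2
  A ⊖ B = mat (m₁₁ A - m₁₁ B) (m₁₂ A - m₁₂ B) (m₂₁ A - m₂₁ B) (m₂₂ A - m₂₂ B)

  _·_ : Carrier → M2 → M2
  s · A = mat (s * m₁₁ A) (s * m₁₂ A) (s * m₂₁ A) (s * m₂₂ A)

  _≋_ : M2 → M2 → Set ℓ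
  A ≋ B = (m₁₁ A ≈ m₁₁ B) × (m₁₂ A ≈ m₁₂ B) × (m₂₁ A ≈ m₂₁ B) × (m₂₂ A ≈ m₂₂ B)

  det : M2 → Carrier
  det A = m₁₁ A * m₂₂ A - m₁₂ A * m₂₁ A

  I₂ : M2
  I₂ = mat 1# 0# 0# 1#

  _^′_ : Carrier → ℕ → Carrier
  x ^′ zero = 1#
  x ^′ suc n = x * (x ^′ n)

  μ-letter : Bit → M2
  μ-letter b0 = mat (q + q ^′ 2) 1# q 1#
  μ-letter b1 = mat (q + (q ^′ 2 + q ^′ 2) + q ^′ 3 + q ^′ 4) (1# + q) (q + q ^′ 2) 1#

  μ : List Bit → M2
  μ = foldr (λ a M → μ-letter a ⊗ M) I₂

  D : M2
  D = μ (b1 ∷ b0 ∷ []) ⊖ μ (b0 ∷ b1 ∷ [])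

  D-explicit : M2
  D-explicit = mat 0# (q + q ^′ 4) (- (q ^′ 2 + q ^′ 5)) 0#

-- μ_q is a monoid morphism, so the difference factors as
-- μ(ũ) (μ(10) − μ(01)) μ(u) = μ(ũ) D μ(u).  D is a multiple of [[0,1],[−q,0]]
-- and each letter matrix M has m₂₁ = q m₁₂, which is exactly the condition
-- M D = D adj(M).  As adj reverses products, μ(ũ) D = D adj(μ(u)), and
-- adj(μ(u)) μ(u) = det(μ(u)) I.  Finally det μ(0) = q² and det μ(1) = q⁴.
module Submission where

open import Algebra.Bundles using (CommutativeRing)
open import Algebra.Solver.Ring.AlmostCommutativeRing
  using (fromCommutativeRing; _-Raw-AlmostCommutative⟶_)
open import Data.Fin using (#_)
open import Data.Integer.Base as ℤ using (ℤ; +_; -[1+_])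
import Data.Integer.Properties as ℤ
open import Data.List.Base using (List; []; _∷_; reverse; _++_; [_])
import Data.List.Properties as List
open import Data.Maybe.Base using (Maybe; map)
open import Data.Nat.Base as ℕ using (ℕ; zero; suc)
  renaming (_+_ to _+ℕ_; _*_ to _*ℕ_)
import Data.Nat.Properties as ℕ
open import Data.Product.Base using (_×_; _,_; ∃)
open import Data.Sign.Base as Sign using ()
open import Data.Vec.Base using (Vec; []; _∷_)
open import Function.Base using (_∘_)
open import Relation.Binary.Bundles using (Setoid)
open import Relation.Binary.Consequences using (dec⇒weaklyDec)
open import Relation.Binary.PropositionalEquality as ≡ using (_≡_)
import Relation.Binary.Reasoning.Setoid
open import Relation.Binary.Structures using (IsEquivalence)

open import Defs

-- The ring solver of Algebra.Solver.Ring with integer coefficients, through the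
-- canonical map ℤ → R.  It is built from the TC-optimised _×_ so that ⟦ + 0 ⟧ℤ and
-- ⟦ + 1 ⟧ℤ compute to 0# and 1#, the constants appearing in the goals below.
module IntegerCoefficients {c ℓ} (R : CommutativeRing c ℓ) where
  open CommutativeRing R
  open import Algebra.Properties.Ring ring
    using (-0#≈0#; -‿involutive; -‿distribˡ-*; -‿distribʳ-*)
  open import Algebra.Properties.AbelianGroup +-abelianGroup using (⁻¹-∙-comm)
  open import Algebra.Properties.Semiring.Mult.TCOptimised semiring
    using (1+×; ×-homo-+; ×1-homo-*) renaming (_×_ to _×′_)
  open import Relation.Binary.Reasoning.Setoid setoid

  ⟦_⟧ℤ : ℤ → Carrier
  ⟦ + n ⟧ℤ = n ×′ 1#
  ⟦ -[1+ n ] ⟧ℤ = - (suc n ×′ 1#)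

  x+y-[x+z]≈y-z : ∀ x y z → (x + y) - (x + z) ≈ y - z
  x+y-[x+z]≈y-z x y z = begin
    (x + y) + - (x + z)   ≈⟨ +-cong (+-comm x y) (sym (⁻¹-∙-comm x z)) ⟩
    (y + x) + (- x + - z) ≈⟨ +-assoc y x _ ⟩
    y + (x + (- x + - z)) ≈⟨ +-congˡ (sym (+-assoc x (- x) (- z))) ⟩
    y + ((x - x) + - z)   ≈⟨ +-congˡ (+-congʳ (-‿inverseʳ x)) ⟩
    y + (0# + - z)        ≈⟨ +-congˡ (+-identityˡ (- z)) ⟩
    y - z                 ∎

  ⊖-homo : ∀ m n → ⟦ m ℤ.⊖ n ⟧ℤ ≈ m ×′ 1# - n ×′ 1#
  ⊖-homo m zero = sym (trans (+-congˡ -0#≈0#) (+-identityʳ (m ×′ 1#)))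
  ⊖-homo zero (suc n) = sym (+-identityˡ _)
  ⊖-homo (suc m) (suc n) = begin
    ⟦ suc m ℤ.⊖ suc n ⟧ℤ              ≡⟨ ≡.cong ⟦_⟧ℤ (ℤ.[1+m]⊖[1+n]≡m⊖n m n) ⟩
    ⟦ m ℤ.⊖ n ⟧ℤ                      ≈⟨ ⊖-homo m n ⟩
    m ×′ 1# - n ×′ 1#                 ≈⟨ x+y-[x+z]≈y-z 1# (m ×′ 1#) (n ×′ 1#) ⟨
    (1# + m ×′ 1#) - (1# + n ×′ 1#)   ≈⟨ +-cong (1+× m 1#) (-‿cong (1+× n 1#)) ⟨
    suc m ×′ 1# - suc n ×′ 1#         ∎

  +-homo : ∀ i j → ⟦ i ℤ.+ j ⟧ℤ ≈ ⟦ i ⟧ℤ + ⟦ j ⟧ℤ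
  +-homo (+ m) (+ n) = ×-homo-+ 1# m n
  +-homo (+ m) -[1+ n ] = ⊖-homo m (suc n)
  +-homo -[1+ m ] (+ n) = trans (⊖-homo n (suc m)) (+-comm _ _)
  +-homo -[1+ m ] -[1+ n ] = begin
    - (suc (suc (m ℕ.+ n)) ×′ 1#)      ≡⟨ ≡.cong (λ k → - (suc k ×′ 1#)) (ℕ.+-suc m n) ⟨
    - ((suc m ℕ.+ suc n) ×′ 1#)        ≈⟨ -‿cong (×-homo-+ 1# (suc m) (suc n)) ⟩
    - (suc m ×′ 1# + suc n ×′ 1#)      ≈⟨ ⁻¹-∙-comm _ _ ⟨
    - (suc m ×′ 1#) + - (suc n ×′ 1#)  ∎

  +◃-homo : ∀ n → ⟦ Sign.+ ℤ.◃ n ⟧ℤ ≈ n ×′ 1#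
  +◃-homo zero = refl
  +◃-homo (suc n) = refl

  -◃-homo : ∀ n → ⟦ Sign.- ℤ.◃ n ⟧ℤ ≈ - (n ×′ 1#)
  -◃-homo zero = sym -0#≈0#
  -◃-homo (suc n) = refl

  *-homo : ∀ i j → ⟦ i ℤ.* j ⟧ℤ ≈ ⟦ i ⟧ℤ * ⟦ j ⟧ℤ
  *-homo (+ m) (+ n) = trans (+◃-homo (m ℕ.* n)) (×1-homo-* m n)
  *-homo (+ m) -[1+ n ] = begin
    ⟦ Sign.- ℤ.◃ m ℕ.* suc n ⟧ℤ  ≈⟨ -◃-homo (m ℕ.* suc n) ⟩
    - ((m ℕ.* suc n) ×′ 1#)      ≈⟨ -‿cong (×1-homo-* m (suc n)) ⟩
    - (m ×′ 1# * suc n ×′ 1#)    ≈⟨ -‿distribʳ-* _ _ ⟩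
    m ×′ 1# * - (suc n ×′ 1#)    ∎
  *-homo -[1+ m ] (+ n) = begin
    ⟦ Sign.- ℤ.◃ suc m ℕ.* n ⟧ℤ  ≈⟨ -◃-homo (suc m ℕ.* n) ⟩
    - ((suc m ℕ.* n) ×′ 1#)      ≈⟨ -‿cong (×1-homo-* (suc m) n) ⟩
    - (suc m ×′ 1# * n ×′ 1#)    ≈⟨ -‿distribˡ-* _ _ ⟩
    - (suc m ×′ 1#) * n ×′ 1#    ∎
  *-homo -[1+ m ] -[1+ n ] = begin
    ⟦ Sign.+ ℤ.◃ suc m ℕ.* suc n ⟧ℤ  ≈⟨ +◃-homo (suc m ℕ.* suc n) ⟩
    (suc m ℕ.* suc n) ×′ 1#          ≈⟨ ×1-homo-* (suc m) (suc n) ⟩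
    x * y                            ≈⟨ -‿involutive _ ⟨
    - - (x * y)                      ≈⟨ -‿cong (-‿distribˡ-* x y) ⟩
    - (- x * y)                      ≈⟨ -‿distribʳ-* (- x) y ⟩
    - x * - y                        ∎
    where
    x y : Carrier
    x = suc m ×′ 1#
    y = suc n ×′ 1#

  -‿homo : ∀ i → ⟦ ℤ.- i ⟧ℤ ≈ - ⟦ i ⟧ℤ
  -‿homo (+ zero) = sym -0#≈0#
  -‿homo (+ suc n) = refl
  -‿homo -[1+ n ] = sym (-‿involutive _)

  ℤ⟶R : ℤ.+-*-rawRing -Raw-AlmostCommutative⟶ fromCommutativeRing R
  ℤ⟶R = record
    { ⟦_⟧ = ⟦_⟧ℤ ; +-homo = +-homo ; *-homo = *-homo ; -‿homo = -‿homo
    ; 0-homo = refl ; 1-homo = refl }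

  ⟦⟧ℤ-weaklyDec : ∀ i j → Maybe (⟦ i ⟧ℤ ≈ ⟦ j ⟧ℤ)
  ⟦⟧ℤ-weaklyDec i j = map (reflexive ∘ ≡.cong ⟦_⟧ℤ) (dec⇒weaklyDec ℤ._≟_ i j)

  open import Algebra.Solver.Ring ℤ.+-*-rawRing (fromCommutativeRing R) ℤ⟶R ⟦⟧ℤ-weaklyDec public

module MatrixLaws {c ℓ} (R : CommutativeRing c ℓ) (q : CommutativeRing.Carrier R) where
  open Mat R q
  open IntegerCoefficients R
    using (Polynomial; con; var; _:+_; _:*_; _:-_; :-_; _:^_; ⟦_⟧; ⟦_⟧↓; prove)

  ≋-isEquivalence : IsEquivalence _≋_
  ≋-isEquivalence = record
    { refl = refl , refl , refl , refl
    ; sym = λ (a , b , c , d) → sym a , sym b , sym c , sym d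
    ; trans = λ (a , b , c , d) (e , f , g , h) → trans a e , trans b f , trans c g , trans d h
    }

  ≋-setoid : Setoid c ℓ
  ≋-setoid = record { isEquivalence = ≋-isEquivalence }

  open Setoid ≋-setoid public using () renaming (refl to ≋-refl; sym to ≋-sym; trans to ≋-trans)

  ⊗-cong : ∀ {A A′ B B′} → A ≋ A′ → B ≋ B′ → A ⊗ B ≋ A′ ⊗ B′
  ⊗-cong (a , b , c , d) (e , f , g , h) =
    +-cong (*-cong a e) (*-cong b g) , +-cong (*-cong a f) (*-cong b h) ,
    +-cong (*-cong c e) (*-cong d g) , +-cong (*-cong c f) (*-cong d h)

  ⊖-cong : ∀ {A A′ B B′} → A ≋ A′ → B ≋ B′ → A ⊖ B ≋ A′ ⊖ B′
  ⊖-cong (a , b , c , d) (e , f , g , h) =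
    +-cong a (-‿cong e) , +-cong b (-‿cong f) , +-cong c (-‿cong g) , +-cong d (-‿cong h)

  ·-cong : ∀ {s t A B} → s ≈ t → A ≋ B → s · A ≋ t · B
  ·-cong s≈t (a , b , c , d) = *-cong s≈t a , *-cong s≈t b , *-cong s≈t c , *-cong s≈t d

  adj : M2 → M2
  adj A = mat (m₂₂ A) (- m₁₂ A) (- m₂₁ A) (m₁₁ A)

  -- Matrices of polynomial expressions.  ⟦ A ⟧ₘ ρ computes to an M2, so a matrix
  -- identity follows from entrywise equality of normal forms, checked by ≋-refl.
  record PolyM2 (n : ℕ) : Set c where
    constructor pm
    field
      p₁₁ p₁₂ p₂₁ p₂₂ : Polynomial n

  module _ {n : ℕ} where
    open PolyM2
    infixl 7 _⊗ₚ_ _·ₚ_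
    infixl 6 _⊖ₚ_

    _⊗ₚ_ : PolyM2 n → PolyM2 n → PolyM2 n
    A ⊗ₚ B = pm (p₁₁ A :* p₁₁ B :+ p₁₂ A :* p₂₁ B) (p₁₁ A :* p₁₂ B :+ p₁₂ A :* p₂₂ B)
                (p₂₁ A :* p₁₁ B :+ p₂₂ A :* p₂₁ B) (p₂₁ A :* p₁₂ B :+ p₂₂ A :* p₂₂ B)

    _⊖ₚ_ : PolyM2 n → PolyM2 n → PolyM2 n
    A ⊖ₚ B = pm (p₁₁ A :- p₁₁ B) (p₁₂ A :- p₁₂ B) (p₂₁ A :- p₂₁ B) (p₂₂ A :- p₂₂ B)

    _·ₚ_ : Polynomial n → PolyM2 n → PolyM2 n
    s ·ₚ A = pm (s :* p₁₁ A) (s :* p₁₂ A) (s :* p₂₁ A) (s :* p₂₂ A)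

    adjₚ : PolyM2 n → PolyM2 n
    adjₚ A = pm (p₂₂ A) (:- p₁₂ A) (:- p₂₁ A) (p₁₁ A)

    detₚ : PolyM2 n → Polynomial n
    detₚ A = p₁₁ A :* p₂₂ A :- p₁₂ A :* p₂₁ A

    I₂ₚ : PolyM2 n
    I₂ₚ = pm (con (+ 1)) (con (+ 0)) (con (+ 0)) (con (+ 1))

    ⟦_⟧ₘ : PolyM2 n → Vec Carrier n → M2
    ⟦ A ⟧ₘ ρ = mat (⟦ p₁₁ A ⟧ ρ) (⟦ p₁₂ A ⟧ ρ) (⟦ p₂₁ A ⟧ ρ) (⟦ p₂₂ A ⟧ ρ)

    ⟦_⟧ₘ↓ : PolyM2 n → Vec Carrier n → M2
    ⟦ A ⟧ₘ↓ ρ = mat (⟦ p₁₁ A ⟧↓ ρ) (⟦ p₁₂ A ⟧↓ ρ) (⟦ p₂₁ A ⟧↓ ρ) (⟦ p₂₂ A ⟧↓ ρ)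

    proveₘ : ∀ ρ A B → ⟦ A ⟧ₘ↓ ρ ≋ ⟦ B ⟧ₘ↓ ρ → ⟦ A ⟧ₘ ρ ≋ ⟦ B ⟧ₘ ρ
    proveₘ ρ A B (e₁₁ , e₁₂ , e₂₁ , e₂₂) =
      prove ρ (p₁₁ A) (p₁₁ B) e₁₁ , prove ρ (p₁₂ A) (p₁₂ B) e₁₂ ,
      prove ρ (p₂₁ A) (p₂₁ B) e₂₁ , prove ρ (p₂₂ A) (p₂₂ B) e₂₂

  𝐀 : ∀ {n} → PolyM2 (4 ℕ.+ n)
  𝐀 = pm (var (# 0)) (var (# 1)) (var (# 2)) (var (# 3))

  𝐁 : ∀ {n} → PolyM2 (8 ℕ.+ n)
  𝐁 = pm (var (# 4)) (var (# 5)) (var (# 6)) (var (# 7))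

  𝐂 : ∀ {n} → PolyM2 (12 ℕ.+ n)
  𝐂 = pm (var (# 8)) (var (# 9)) (var (# 10)) (var (# 11))

  ⊗-assoc : ∀ A B C → (A ⊗ B) ⊗ C ≋ A ⊗ (B ⊗ C)
  ⊗-assoc (mat a b c d) (mat e f g h) (mat i j k l) =
    proveₘ (a ∷ b ∷ c ∷ d ∷ e ∷ f ∷ g ∷ h ∷ i ∷ j ∷ k ∷ l ∷ [])
      ((𝐀 ⊗ₚ 𝐁) ⊗ₚ 𝐂) (𝐀 ⊗ₚ (𝐁 ⊗ₚ 𝐂)) ≋-refl

  ⊗-identityˡ : ∀ A → I₂ ⊗ A ≋ A
  ⊗-identityˡ (mat a b c d) = proveₘ (a ∷ b ∷ c ∷ d ∷ []) (I₂ₚ ⊗ₚ 𝐀) 𝐀 ≋-refl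

  adj-I₂ : adj I₂ ≋ I₂
  adj-I₂ = proveₘ [] (adjₚ I₂ₚ) I₂ₚ ≋-refl

  ⊗-identityʳ : ∀ A → A ⊗ I₂ ≋ A
  ⊗-identityʳ (mat a b c d) = proveₘ (a ∷ b ∷ c ∷ d ∷ []) (𝐀 ⊗ₚ I₂ₚ) 𝐀 ≋-refl

  ⊗-distribˡ-⊖ : ∀ A B C → A ⊗ (B ⊖ C) ≋ A ⊗ B ⊖ A ⊗ C
  ⊗-distribˡ-⊖ (mat a b c d) (mat e f g h) (mat i j k l) =
    proveₘ (a ∷ b ∷ c ∷ d ∷ e ∷ f ∷ g ∷ h ∷ i ∷ j ∷ k ∷ l ∷ [])
      (𝐀 ⊗ₚ (𝐁 ⊖ₚ 𝐂)) (𝐀 ⊗ₚ 𝐁 ⊖ₚ 𝐀 ⊗ₚ 𝐂) ≋-refl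

  ⊗-distribʳ-⊖ : ∀ A B C → (A ⊖ B) ⊗ C ≋ A ⊗ C ⊖ B ⊗ C
  ⊗-distribʳ-⊖ (mat a b c d) (mat e f g h) (mat i j k l) =
    proveₘ (a ∷ b ∷ c ∷ d ∷ e ∷ f ∷ g ∷ h ∷ i ∷ j ∷ k ∷ l ∷ [])
      ((𝐀 ⊖ₚ 𝐁) ⊗ₚ 𝐂) (𝐀 ⊗ₚ 𝐂 ⊖ₚ 𝐁 ⊗ₚ 𝐂) ≋-refl

  ⊗-·-comm : ∀ s A B → A ⊗ (s · B) ≋ s · (A ⊗ B)
  ⊗-·-comm s (mat a b c d) (mat e f g h) =
    proveₘ (a ∷ b ∷ c ∷ d ∷ e ∷ f ∷ g ∷ h ∷ s ∷ [])
      (𝐀 ⊗ₚ (var (# 8) ·ₚ 𝐁)) (var (# 8) ·ₚ (𝐀 ⊗ₚ 𝐁)) ≋-refl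

  adj-anti-homo-⊗ : ∀ A B → adj (A ⊗ B) ≋ adj B ⊗ adj A
  adj-anti-homo-⊗ (mat a b c d) (mat e f g h) =
    proveₘ (a ∷ b ∷ c ∷ d ∷ e ∷ f ∷ g ∷ h ∷ [])
      (adjₚ (𝐀 ⊗ₚ 𝐁)) (adjₚ 𝐁 ⊗ₚ adjₚ 𝐀) ≋-refl

  adj-⊗-det : ∀ A → adj A ⊗ A ≋ det A · I₂
  adj-⊗-det (mat a b c d) =
    proveₘ (a ∷ b ∷ c ∷ d ∷ []) (adjₚ 𝐀 ⊗ₚ 𝐀) (detₚ 𝐀 ·ₚ I₂ₚ) ≋-refl

  det-homo-⊗ : ∀ A B → det (A ⊗ B) ≈ det A * det B
  det-homo-⊗ (mat a b c d) (mat e f g h) =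
    prove (a ∷ b ∷ c ∷ d ∷ e ∷ f ∷ g ∷ h ∷ []) (detₚ (𝐀 ⊗ₚ 𝐁)) (detₚ 𝐀 :* detₚ 𝐁) refl

module WordMatrices {c ℓ} (R : CommutativeRing c ℓ) (q : CommutativeRing.Carrier R) where
  open Mat R q
  open MatrixLaws R q
  open IntegerCoefficients R using (Polynomial; con; var; _:+_; _:-_; :-_; _:^_; prove)
  module ≋-Reasoning = Relation.Binary.Reasoning.Setoid ≋-setoid
  module ≈-Reasoning = Relation.Binary.Reasoning.Setoid setoid

  qₚ : Polynomial 1
  qₚ = var (# 0)

  μ-letterₚ : Bit → PolyM2 1
  μ-letterₚ b0 = pm (qₚ :+ qₚ :^ 2) (con (+ 1)) qₚ (con (+ 1))
  μ-letterₚ b1 =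
    pm (qₚ :+ (qₚ :^ 2 :+ qₚ :^ 2) :+ qₚ :^ 3 :+ qₚ :^ 4) (con (+ 1) :+ qₚ) (qₚ :+ qₚ :^ 2) (con (+ 1))

  Dₚ : PolyM2 1
  Dₚ = μ-letterₚ b1 ⊗ₚ (μ-letterₚ b0 ⊗ₚ I₂ₚ) ⊖ₚ μ-letterₚ b0 ⊗ₚ (μ-letterₚ b1 ⊗ₚ I₂ₚ)

  D≋D-explicit : D ≋ D-explicit
  D≋D-explicit =
    proveₘ (q ∷ []) Dₚ (pm (con (+ 0)) (qₚ :+ qₚ :^ 4) (:- (qₚ :^ 2 :+ qₚ :^ 5)) (con (+ 0))) ≋-refl

  -- D = (q + q⁴) [[0,1],[−q,0]], and M D = D adj(M) amounts to m₂₁ = q m₁₂.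
  μ-letter-⊗-D : ∀ a → μ-letter a ⊗ D ≋ D ⊗ adj (μ-letter a)
  μ-letter-⊗-D b0 = proveₘ (q ∷ []) (μ-letterₚ b0 ⊗ₚ Dₚ) (Dₚ ⊗ₚ adjₚ (μ-letterₚ b0)) ≋-refl
  μ-letter-⊗-D b1 = proveₘ (q ∷ []) (μ-letterₚ b1 ⊗ₚ Dₚ) (Dₚ ⊗ₚ adjₚ (μ-letterₚ b1)) ≋-refl

  weight : Bit → ℕ
  weight b0 = 2
  weight b1 = 4

  det-μ-letter : ∀ a → det (μ-letter a) ≈ q ^′ weight a
  det-μ-letter b0 = prove (q ∷ []) (detₚ (μ-letterₚ b0)) (qₚ :^ 2) refl
  det-μ-letter b1 = prove (q ∷ []) (detₚ (μ-letterₚ b1)) (qₚ :^ 4) refl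

  ^′-homo-+ : ∀ y m n → y ^′ (m ℕ.+ n) ≈ y ^′ m * y ^′ n
  ^′-homo-+ y zero n = sym (*-identityˡ (y ^′ n))
  ^′-homo-+ y (suc m) n = trans (*-congˡ (^′-homo-+ y m n)) (sym (*-assoc y _ _))

  exponent : List Bit → ℕ
  exponent u = 2 ℕ.* count0 u ℕ.+ 4 ℕ.* count1 u

  exponent-∷ : ∀ a u → exponent (a ∷ u) ≡ weight a ℕ.+ exponent u
  exponent-∷ b0 u = ≡.trans (≡.cong (ℕ._+ 4 ℕ.* count1 u) (ℕ.*-suc 2 (count0 u)))
                             (ℕ.+-assoc 2 (2 ℕ.* count0 u) (4 ℕ.* count1 u))
  exponent-∷ b1 u = ≡.trans (≡.cong (2 ℕ.* count0 u ℕ.+_) (ℕ.*-suc 4 (count1 u)))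
                             (x∙yz≈y∙xz (2 ℕ.* count0 u) 4 (4 ℕ.* count1 u))
    where
    open import Algebra.Properties.CommutativeSemigroup ℕ.+-commutativeSemigroup
      using (x∙yz≈y∙xz)

  det-μ : ∀ u → det (μ u) ≈ q ^′ exponent u
  det-μ [] = prove [] (detₚ I₂ₚ) (con (+ 1)) refl
  det-μ (a ∷ u) = begin
    det (μ-letter a ⊗ μ u)               ≈⟨ det-homo-⊗ (μ-letter a) (μ u) ⟩
    det (μ-letter a) * det (μ u)         ≈⟨ *-cong (det-μ-letter a) (det-μ u) ⟩
    q ^′ weight a * q ^′ exponent u      ≈⟨ ^′-homo-+ q (weight a) (exponent u) ⟨
    q ^′ (weight a ℕ.+ exponent u)       ≡⟨ ≡.cong (q ^′_) (exponent-∷ a u) ⟨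
    q ^′ exponent (a ∷ u)                ∎
    where open ≈-Reasoning

  μ-homo-++ : ∀ u v → μ (u ++ v) ≋ μ u ⊗ μ v
  μ-homo-++ [] v = ≋-sym (⊗-identityˡ (μ v))
  μ-homo-++ (a ∷ u) v =
    ≋-trans (⊗-cong ≋-refl (μ-homo-++ u v)) (≋-sym (⊗-assoc (μ-letter a) (μ u) (μ v)))

  μ-reverse-⊗-intertwining : ∀ X → (∀ a → μ-letter a ⊗ X ≋ X ⊗ adj (μ-letter a)) →
                             ∀ u → μ (reverse u) ⊗ X ≋ X ⊗ adj (μ u)
  μ-reverse-⊗-intertwining X letter [] = begin
    I₂ ⊗ X       ≈⟨ ⊗-identityˡ X ⟩
    X            ≈⟨ ⊗-identityʳ X ⟨
    X ⊗ I₂       ≈⟨ ⊗-cong ≋-refl adj-I₂ ⟨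
    X ⊗ adj I₂   ∎
    where open ≋-Reasoning
  μ-reverse-⊗-intertwining X letter (a ∷ u) = begin
    μ (reverse (a ∷ u)) ⊗ X               ≡⟨ ≡.cong (λ w → μ w ⊗ X) (List.unfold-reverse a u) ⟩
    μ (reverse u ++ [ a ]) ⊗ X            ≈⟨ ⊗-cong (μ-homo-++ (reverse u) [ a ]) ≋-refl ⟩
    (μ (reverse u) ⊗ μ [ a ]) ⊗ X         ≈⟨ ⊗-assoc (μ (reverse u)) (μ [ a ]) X ⟩
    μ (reverse u) ⊗ (μ [ a ] ⊗ X)         ≈⟨ ⊗-cong ≋-refl (⊗-cong (⊗-identityʳ (μ-letter a)) ≋-refl) ⟩
    μ (reverse u) ⊗ (μ-letter a ⊗ X)      ≈⟨ ⊗-cong ≋-refl (letter a) ⟩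
    μ (reverse u) ⊗ (X ⊗ adj (μ-letter a)) ≈⟨ ⊗-assoc (μ (reverse u)) X (adj (μ-letter a)) ⟨
    (μ (reverse u) ⊗ X) ⊗ adj (μ-letter a) ≈⟨ ⊗-cong (μ-reverse-⊗-intertwining X letter u) ≋-refl ⟩
    (X ⊗ adj (μ u)) ⊗ adj (μ-letter a)     ≈⟨ ⊗-assoc X (adj (μ u)) (adj (μ-letter a)) ⟩
    X ⊗ (adj (μ u) ⊗ adj (μ-letter a))     ≈⟨ ⊗-cong ≋-refl (adj-anti-homo-⊗ (μ-letter a) (μ u)) ⟨
    X ⊗ adj (μ (a ∷ u))                    ∎
    where open ≋-Reasoning

  μ-swap : ∀ u → μ (b1 ∷ b0 ∷ u) ⊖ μ (b0 ∷ b1 ∷ u) ≋ D ⊗ μ u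
  μ-swap u = begin
    μ (b1 ∷ b0 ∷ u) ⊖ μ (b0 ∷ b1 ∷ u)
      ≈⟨ ⊖-cong (μ-homo-++ (b1 ∷ b0 ∷ []) u) (μ-homo-++ (b0 ∷ b1 ∷ []) u) ⟩
    μ (b1 ∷ b0 ∷ []) ⊗ μ u ⊖ μ (b0 ∷ b1 ∷ []) ⊗ μ u
      ≈⟨ ⊗-distribʳ-⊖ (μ (b1 ∷ b0 ∷ [])) (μ (b0 ∷ b1 ∷ [])) (μ u) ⟨
    D ⊗ μ u ∎
    where open ≋-Reasoning

  μ-difference : ∀ u → μ (reverse u ++ b1 ∷ b0 ∷ u) ⊖ μ (reverse u ++ b0 ∷ b1 ∷ u) ≋ det (μ u) · D
  μ-difference u = begin
    μ (reverse u ++ b1 ∷ b0 ∷ u) ⊖ μ (reverse u ++ b0 ∷ b1 ∷ u)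
      ≈⟨ ⊖-cong (μ-homo-++ (reverse u) _) (μ-homo-++ (reverse u) _) ⟩
    Ũ ⊗ μ (b1 ∷ b0 ∷ u) ⊖ Ũ ⊗ μ (b0 ∷ b1 ∷ u)  ≈⟨ ⊗-distribˡ-⊖ Ũ _ _ ⟨
    Ũ ⊗ (μ (b1 ∷ b0 ∷ u) ⊖ μ (b0 ∷ b1 ∷ u))    ≈⟨ ⊗-cong ≋-refl (μ-swap u) ⟩
    Ũ ⊗ (D ⊗ μ u)                              ≈⟨ ⊗-assoc Ũ D (μ u) ⟨
    (Ũ ⊗ D) ⊗ μ u                              ≈⟨ ⊗-cong (μ-reverse-⊗-intertwining D μ-letter-⊗-D u) ≋-refl ⟩
    (D ⊗ adj (μ u)) ⊗ μ u                      ≈⟨ ⊗-assoc D (adj (μ u)) (μ u) ⟩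
    D ⊗ (adj (μ u) ⊗ μ u)                      ≈⟨ ⊗-cong ≋-refl (adj-⊗-det (μ u)) ⟩
    D ⊗ (det (μ u) · I₂)                       ≈⟨ ⊗-·-comm (det (μ u)) D I₂ ⟩
    det (μ u) · (D ⊗ I₂)                       ≈⟨ ·-cong refl (⊗-identityʳ D) ⟩
    det (μ u) · D                              ∎
    where
    open ≋-Reasoning
    Ũ : M2
    Ũ = μ (reverse u)

lemma3p4 : ∀ {c ℓ} (R : CommutativeRing c ℓ) (q : CommutativeRing.Carrier R)
    → (∃ λ q⁻ → CommutativeRing._≈_ R (CommutativeRing._*_ R q q⁻) (CommutativeRing.1# R))
    → (u : List Bit)
    → let open Mat R q
          n = 2 *ℕ count0 u +ℕ 4 *ℕ count1 u
      in (μ (reverse u ++ b1 ∷ b0 ∷ u) ⊖ μ (reverse u ++ b0 ∷ b1 ∷ u) ≋ (q ^′ n) · D)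
         × ((q ^′ n) · D ≋ det (μ u) · D)
         × (D ≋ D-explicit)
lemma3p4 R q _ u =
    ≋-trans (μ-difference u) (≋-sym q^n·D≋det·D) , q^n·D≋det·D , D≋D-explicit
  where
  open Mat R q
  open MatrixLaws R q
  open WordMatrices R q
  q^n·D≋det·D : q ^′ exponent u · D ≋ det (μ u) · D
  q^n·D≋det·D = ·-cong (sym (det-μ u)) ≋-refl
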